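{- Let $r \geq 3$ be an integer. There is a constant $C$ (depending on $r$) such that if $(H,\mathcal{F})$ is an $(r,r)$-system with $|\mathcal{F}|\geq C$, then $H$ has (at least) $r-3$ conical vertices.
   Context: All graphs are finite and simple. A conical vertex of a graph is a vertex adjacent to all other vertices. For $r\ge 3$, an $r$-system is a pair $(H,\mathcal{F})$ where $H$ is a graph and $\mathcal{F}$ is a family of subsets of $V(H)$ such that: (i) $H$ contains no $K_r$; (ii) every $S\in\mathcal{F}$ is maximally $K_{r-1}$-free ($H[S]$ has no $K_{r-1}$ but $H[S\cup\{v\}]$ has a $K_{r-1}$ for every $v\notin S$); (iii) for distinct $S\neq T$ in $\mathcal{F}$, $H[S\cap T]$ contains a $K_{r-2}$. An $(r,t)$-system is an $r$-system with no repeated sets in $\mathcal{F}$ and all sets of size exactly $t$. -}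

module Defs where

open import Data.Nat using (ℕ; _≥_; _∸_)
open import Data.Bool using (Bool; true; false)
open import Data.Fin using (Fin)
open import Data.Fin.Subset using (Subset; _∈_; _∉_; _∪_; _∩_; ⁅_⁆; ⊤; ∣_∣)
open import Data.List using (List; length)
import Data.List.Membership.Propositional as LM
open import Data.List.Relation.Unary.Unique.Propositional using (Unique)
open import Data.Product using (Σ; _×_)
open import Relation.Binary.PropositionalEquality using (_≡_; _≢_)
open import Relation.Nullary using (¬_)

record Graph (n : ℕ) : Set where
  field
    adj    : Fin n → Fin n → Bool
    sym    : ∀ u v → adj u v ≡ adj v u
    irrefl : ∀ v → adj v v ≡ false
open Graph public

Adj : ∀ {n} → Graph n → Fin n → Fin n → Set
Adj G u v = adj G u v ≡ true

-- H[X] contains a copy of K_k: k pairwise adjacent (hence distinct)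
-- vertices, all lying in X.
HasClique : ∀ {n} → Graph n → ℕ → Subset n → Set
HasClique {n} G k X =
  Σ (Fin k → Fin n) λ f →
    (∀ i → f i ∈ X) × (∀ i j → i ≢ j → Adj G (f i) (f j))

MaxFree : ∀ {n} → Graph n → ℕ → Subset n → Set
MaxFree G k S =
  ¬ HasClique G k S × (∀ v → v ∉ S → HasClique G k (S ∪ ⁅ v ⁆))

IsRSystem : ∀ {n} → ℕ → Graph n → List (Subset n) → Set
IsRSystem r H F =
  ¬ HasClique H r ⊤ ×
  (∀ S → S LM.∈ F → MaxFree H (r ∸ 1) S) ×
  (∀ S T → S LM.∈ F → T LM.∈ F → S ≢ T → HasClique H (r ∸ 2) (S ∩ T))

IsRTSystem : ∀ {n} → ℕ → ℕ → Graph n → List (Subset n) → Set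
IsRTSystem r t H F =
  IsRSystem r H F × Unique F × (∀ S → S LM.∈ F → ∣ S ∣ ≡ t)

Conical : ∀ {n} → Graph n → Fin n → Set
Conical G v = ∀ w → w ≢ v → Adj G v w

{-# OPTIONS --safe #-}
module Submission where

-- Write k = r − 2. Fix S₀ ∈ F and keep only the sets of F that agree on each vertex of S₀;
-- a 2⁻ʳ fraction survives, so a k-clique A in S₀ ∩ T₁ lies in all of them and each is A plus
-- two petal vertices. Sets sharing a petal vertex have adjacent other petals, so a vertex is
-- a petal of at most k + 1 sets, and greedily we get 2(k + 2) sets with disjoint petals.
-- The tool throughout: for T ∈ F and u ∉ T, maximality gives a K_{k+1} through u in
-- T ∪ {u}, and it misses exactly two of those k + 3 vertices. Take a petal p of one set and
-- A a ≁ p; for every other set the clique through p misses A a and one more vertex, giving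
-- k + 1 classes. Three sets in one class either produce a set whose two petals are adjacent
-- to all of A − A a, which forces the k − 1 = r − 3 vertices of A − A a to be conical, or a K_r.

open import Data.Bool using (true)
import Data.Bool.Properties as Bool
open import Data.Empty using (⊥; ⊥-elim)
open import Data.Fin using (Fin; zero; suc; punchIn; punchOut)
import Data.Fin.Properties as Finₚ
open import Data.Fin.Subset renaming (⊥ to ∅) hiding (Empty)
open import Data.Fin.Subset.Properties
open import Data.List as List using (List; []; _∷_; length; filter)
import Data.List.Properties as Listₚ
open import Data.List.Membership.Propositional using () renaming (_∈_ to _∈ₗ_)
import Data.List.Membership.Propositional.Properties as ∈ₗ
open import Data.List.Relation.Unary.All as All using (All; []; _∷_)
import Data.List.Relation.Unary.All.Properties as All
open import Data.List.Relation.Unary.AllPairs using (AllPairs; []; _∷_)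
import Data.List.Relation.Unary.AllPairs.Properties as AllPairs
open import Data.List.Relation.Unary.Any using (here; there)
import Data.List.Relation.Binary.Sublist.Propositional.Properties as Sublist
open import Data.Nat using (ℕ; zero; suc; _+_; _*_; _∸_; _^_; _≤_; _<_; _≥_; z≤n; s≤s)
open import Data.Nat.Properties
open import Data.Product using (∃; ∃₂; Σ; _×_; _,_; proj₁; proj₂)
open import Data.Sum as Sum using (_⊎_; inj₁; inj₂)
open import Data.Vec using (_∷_; []; here; there)
import Data.Vec.Properties as Vecₚ
open import Data.Vec.Functional using (removeAt) renaming (_∷_ to _∷ᶠ_)
open import Function using (_∘_; _on_; id)
open import Function.Definitions using (Injective)
open import Relation.Binary.Core using (Rel)
open import Relation.Binary.Definitions using (DecidableEquality)
open import Relation.Binary.PropositionalEquality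
open import Relation.Nullary using (¬_; Dec; yes; no)
open import Relation.Nullary.Decidable using (decidable-stable; _×-dec_; ¬?)
open import Relation.Unary using (Pred; Decidable)

open import Defs hiding (sym)

∈-∪⁅⁆⁻ : ∀ {n} {p : Subset n} {x y} → x ∈ p ∪ ⁅ y ⁆ → x ∈ p ⊎ x ≡ y
∈-∪⁅⁆⁻ {p = p} {y = y} x∈ = Sum.map₂ (x∈⁅y⁆⇒x≡y y) (x∈p∪q⁻ p ⁅ y ⁆ x∈)

∣p∪⁅x⁆∣≤1+∣p∣ : ∀ {n} (p : Subset n) x → ∣ p ∪ ⁅ x ⁆ ∣ ≤ suc ∣ p ∣
∣p∪⁅x⁆∣≤1+∣p∣ (s ∷ p)       zero    rewrite ∪-identityʳ p with s
... | inside  = n≤1+n (suc ∣ p ∣)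
... | outside = ≤-refl
∣p∪⁅x⁆∣≤1+∣p∣ (inside ∷ p)  (suc x) = s≤s (∣p∪⁅x⁆∣≤1+∣p∣ p x)
∣p∪⁅x⁆∣≤1+∣p∣ (outside ∷ p) (suc x) = ∣p∪⁅x⁆∣≤1+∣p∣ p x

∉∧∈⇒≢ : ∀ {n} {p : Subset n} {x y} → x ∉ p → y ∈ p → x ≢ y
∉∧∈⇒≢ x∉p y∈p refl = x∉p y∈p

3+∣p-x-y-z∣≤∣p∣ : ∀ {n} {p : Subset n} {x y z} → x ∈ p → y ∈ p → z ∈ p →
                  x ≢ y → x ≢ z → y ≢ z → 3 + ∣ p - x - y - z ∣ ≤ ∣ p ∣
3+∣p-x-y-z∣≤∣p∣ {p = p} {x} {y} {z} x∈p y∈p z∈p x≢y x≢z y≢z =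
  ≤-trans (s≤s (s≤s (x∈p⇒∣p-x∣<∣p∣ z∈p-x-y)))
    (≤-trans (s≤s (x∈p⇒∣p-x∣<∣p∣ y∈p-x)) (x∈p⇒∣p-x∣<∣p∣ x∈p))
  where
  y∈p-x = x∈p∧x≢y⇒x∈p-y y∈p (x≢y ∘ sym)
  z∈p-x-y = x∈p∧x≢y⇒x∈p-y (x∈p∧x≢y⇒x∈p-y z∈p (x≢z ∘ sym)) (y≢z ∘ sym)

∣q∣<∣p∣⇒p⊈q : ∀ {n} {p q : Subset n} → ∣ q ∣ < ∣ p ∣ → ∃ λ v → v ∈ p × v ∉ q
∣q∣<∣p∣⇒p⊈q {p = p} {q} ∣q∣<∣p∣ with Finₚ.any? (λ v → v ∈? p ×-dec ¬? (v ∈? q))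
... | yes witness = witness
... | no  none    = ⊥-elim (<⇒≱ ∣q∣<∣p∣ (p⊆q⇒∣p∣≤∣q∣ p⊆q))
  where
  p⊆q : p ⊆ q
  p⊆q {v} v∈p = decidable-stable (v ∈? q) (λ v∉q → none (v , v∈p , v∉q))

image : ∀ {m n} → (Fin m → Fin n) → Subset n
image {zero}  f = ∅
image {suc m} f = image (f ∘ suc) ∪ ⁅ f zero ⁆

∈-image⁺ : ∀ {m n} (f : Fin m → Fin n) i → f i ∈ image f
∈-image⁺ f zero    = x∈p∪q⁺ (inj₂ (x∈⁅x⁆ (f zero)))
∈-image⁺ f (suc i) = x∈p∪q⁺ (inj₁ (∈-image⁺ (f ∘ suc) i))

∈-image⁻ : ∀ {m n} (f : Fin m → Fin n) {v} → v ∈ image f → ∃ λ i → f i ≡ v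
∈-image⁻ {zero}  f v∈ = ⊥-elim (∉⊥ v∈)
∈-image⁻ {suc m} f v∈ with ∈-∪⁅⁆⁻ v∈
... | inj₁ v∈rest = let i , eq = ∈-image⁻ (f ∘ suc) v∈rest in suc i , eq
... | inj₂ v≡f0   = zero , sym v≡f0

∉-image⇒≢ : ∀ {m n} (f : Fin m → Fin n) {v} → v ∉ image f → ∀ i → f i ≢ v
∉-image⇒≢ f v∉ i refl = v∉ (∈-image⁺ f i)

∣image∣≤ : ∀ {m n} (f : Fin m → Fin n) → ∣ image f ∣ ≤ m
∣image∣≤ {zero}  {n} f = ≤-reflexive (∣⊥∣≡0 n)
∣image∣≤ {suc m} f =
  ≤-trans (∣p∪⁅x⁆∣≤1+∣p∣ (image (f ∘ suc)) (f zero)) (s≤s (∣image∣≤ (f ∘ suc)))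

injection⇒≤∣p∣ : ∀ {m n} {p : Subset n} (f : Fin m → Fin n) →
                 Injective _≡_ _≡_ f → (∀ i → f i ∈ p) → m ≤ ∣ p ∣
injection⇒≤∣p∣ {zero}  _ _ _ = z≤n
injection⇒≤∣p∣ {suc m} {p = p} f f-inj f∈p =
  ≤-trans (s≤s (injection⇒≤∣p∣ (f ∘ suc) (Finₚ.suc-injective ∘ f-inj) f∘suc∈p-f0))
          (x∈p⇒∣p-x∣<∣p∣ (f∈p zero))
  where
  f∘suc∈p-f0 : ∀ i → f (suc i) ∈ p - f zero
  f∘suc∈p-f0 i = x∈p∧x≢y⇒x∈p-y (f∈p (suc i)) (λ eq → Finₚ.0≢1+n (sym (f-inj eq)))

injective-∷ : ∀ {m n v} {f : Fin m → Fin n} → Injective _≡_ _≡_ f → (∀ i → f i ≢ v) →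
              Injective _≡_ _≡_ (v ∷ᶠ f)
injective-∷ f-inj f≢v {zero}  {zero}  _  = refl
injective-∷ f-inj f≢v {zero}  {suc j} eq = ⊥-elim (f≢v j (sym eq))
injective-∷ f-inj f≢v {suc i} {zero}  eq = ⊥-elim (f≢v i eq)
injective-∷ f-inj f≢v {suc i} {suc j} eq = cong suc (f-inj eq)

members : ∀ {n} → Subset n → List (Fin n)
members []            = []
members (inside  ∷ p) = zero ∷ List.map suc (members p)
members (outside ∷ p) = List.map suc (members p)

length-members : ∀ {n} (p : Subset n) → length (members p) ≡ ∣ p ∣
length-members []            = refl
length-members (inside  ∷ p) = cong suc (trans (Listₚ.length-map suc (members p)) (length-members p))
length-members (outside ∷ p) = trans (Listₚ.length-map suc (members p)) (length-members p)

∈-members : ∀ {n} {p : Subset n} {x} → x ∈ p → x ∈ₗ members p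
∈-members {p = inside  ∷ p} here        = here refl
∈-members {p = inside  ∷ p} (there x∈p) = there (∈ₗ.∈-map⁺ suc (∈-members x∈p))
∈-members {p = outside ∷ p} (there x∈p) = ∈ₗ.∈-map⁺ suc (∈-members x∈p)

length-filter-split : ∀ {a p} {X : Set a} {P : Pred X p} (P? : Decidable P) (xs : List X) →
                      length xs ≡ length (filter P? xs) + length (filter (¬? ∘ P?) xs)
length-filter-split P? []       = refl
length-filter-split P? (x ∷ xs) with P? x
... | yes _ = cong suc (length-filter-split P? xs)
... | no  _ = trans (cong suc (length-filter-split P? xs)) (sym (+-suc _ _))

pigeonhole-filter : ∀ {a b} {X : Set a} {K : Set b} (_≟_ : DecidableEquality K) (key : X → K)
                    (keys : List K) {c} (xs : List X) → (∀ {x} → x ∈ₗ xs → key x ∈ₗ keys) →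
                    length keys * c < length xs → ∃ λ κ → c < length (filter (λ x → key x ≟ κ) xs)
pigeonhole-filter _≟_ key []       []       _     ()
pigeonhole-filter _≟_ key []       (x ∷ _)  keys⊇ _ with () ← keys⊇ (here refl)
pigeonhole-filter _≟_ key (κ ∷ keys) {c} xs keys⊇ bound with c <? length (filter (λ x → key x ≟ κ) xs)
... | yes many-κ = κ , many-κ
... | no  few-κ  =
  let κ′ , many-κ′ = pigeonhole-filter _≟_ key keys xs′ keys⊇xs′ bound′
  in κ′ , <-≤-trans many-κ′
                (Sublist.length-mono-≤ (Sublist.filter⁺ _ _ (λ { refl → id }) (Sublist.filter-⊆ _ xs)))
  where
  xs′ = filter (λ x → ¬? (key x ≟ κ)) xs
  keys⊇xs′ : ∀ {x} → x ∈ₗ xs′ → key x ∈ₗ keys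
  keys⊇xs′ x∈xs′
    with x∈xs , key≢κ ← ∈ₗ.∈-filter⁻ (λ x → ¬? (key x ≟ κ)) {xs = xs} x∈xs′
    with keys⊇ x∈xs
  ... | here key≡κ = ⊥-elim (key≢κ key≡κ)
  ... | there key∈keys = key∈keys
  bound′ : length keys * c < length xs′
  bound′ = +-cancelˡ-< c _ _ (begin-strict
    c + length keys * c                                  <⟨ bound ⟩
    length xs                                            ≡⟨ length-filter-split (λ x → key x ≟ κ) xs ⟩
    length (filter (λ x → key x ≟ κ) xs) + length xs′    ≤⟨ +-monoˡ-≤ _ (≮⇒≥ few-κ) ⟩
    c + length xs′                                       ∎)
    where open ≤-Reasoning

map-proj₁-toList : ∀ {a p} {X : Set a} {P : Pred X p} {xs} (pxs : All P xs) →
                   List.map proj₁ (All.toList pxs) ≡ xs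
map-proj₁-toList []         = refl
map-proj₁-toList (px ∷ pxs) = cong (_ ∷_) (map-proj₁-toList pxs)

length-toList : ∀ {a p} {X : Set a} {P : Pred X p} {xs} (pxs : All P xs) →
                length (All.toList pxs) ≡ length xs
length-toList pxs =
  trans (sym (Listₚ.length-map proj₁ (All.toList pxs))) (cong length (map-proj₁-toList pxs))

AllPairs-toList : ∀ {a p r} {X : Set a} {P : Pred X p} {R : Rel X r} {xs} → AllPairs R xs → (pxs : All P xs) →
                  AllPairs (R on proj₁) (All.toList pxs)
AllPairs-toList xs-R pxs = AllPairs.map⁻ (subst (AllPairs _) (sym (map-proj₁-toList pxs)) xs-R)

another : ∀ {a} {X : Set a} → DecidableEquality X → ∀ {L : List X} → AllPairs _≢_ L → 2 ≤ length L →
          ∀ x → ∃ λ y → y ∈ₗ L × y ≢ x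
another _≟_ {_ ∷ []} _ (s≤s ()) _
another _≟_ {y₁ ∷ y₂ ∷ _} ((y₁≢y₂ ∷ _) ∷ _) _ x with y₁ ≟ x
... | yes refl = y₂ , there (here refl) , y₁≢y₂ ∘ sym
... | no  y₁≢x = y₁ , here refl , y₁≢x

2^[1+m]*c≡2^m*c+2^m*c : ∀ m c → 2 ^ suc m * c ≡ 2 ^ m * c + 2 ^ m * c
2^[1+m]*c≡2^m*c+2^m*c m c =
  trans (*-distribʳ-+ c (2 ^ m) (2 ^ m + 0)) (cong (λ x → 2 ^ m * c + x * c) (+-identityʳ (2 ^ m)))

homogeneous-sublist : ∀ {n q r} {Q : Pred (Subset n) q} {R : Rel (Subset n) r} (vs : List (Fin n)) {c} {L} →
                      AllPairs R L → All Q L → 2 ^ length vs * c ≤ length L →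
                      ∃ λ L′ → AllPairs R L′ × All Q L′ × c ≤ length L′ ×
                               (∀ {v} → v ∈ₗ vs → All (v ∈_) L′ ⊎ All (v ∉_) L′)
homogeneous-sublist []       {L = L} L-R L-Q bound =
  L , L-R , L-Q , ≤-trans (≤-reflexive (sym (+-identityʳ _))) bound , λ ()
homogeneous-sublist {Q = Q} {R} (v ∷ vs) {c} {L} L-R L-Q bound =
  by-count (2 ^ length vs * c ≤? length (filter (v ∈?_) L))
  where
  Result = ∃ λ L′ → AllPairs R L′ × All Q L′ × c ≤ length L′ ×
                    (∀ {w} → w ∈ₗ v ∷ vs → All (w ∈_) L′ ⊎ All (w ∉_) L′)
  refine : ∀ {p} {P : Pred (Subset _) p} (P? : Decidable P) →
           (∀ {L′} → All P L′ → All (v ∈_) L′ ⊎ All (v ∉_) L′) →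
           2 ^ length vs * c ≤ length (filter P? L) → Result
  refine P? v-homogeneous many
    with L′ , L′-R , L′-QP , c≤L′ , vs-homogeneous ←
         homogeneous-sublist vs (AllPairs.filter⁺ P? L-R)
                             (All.zip (All.filter⁺ P? L-Q , All.all-filter P? L)) many
    = L′ , L′-R , proj₁ (All.unzip L′-QP) , c≤L′ ,
      λ { (here refl) → v-homogeneous (proj₂ (All.unzip L′-QP)) ; (there w∈vs) → vs-homogeneous w∈vs }
  by-count : Dec (2 ^ length vs * c ≤ length (filter (v ∈?_) L)) → Result
  by-count (yes many-in) = refine (v ∈?_) inj₁ many-in
  by-count (no  few-in)  = refine (¬? ∘ (v ∈?_)) inj₂ (+-cancelˡ-≤ (2 ^ length vs * c) _ _ (begin
    2 ^ length vs * c + 2 ^ length vs * c                          ≡⟨ sym (2^[1+m]*c≡2^m*c+2^m*c (length vs) c) ⟩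
    2 ^ suc (length vs) * c                                        ≤⟨ bound ⟩
    length L                                                       ≡⟨ length-filter-split (v ∈?_) L ⟩
    length (filter (v ∈?_) L) + length (filter (¬? ∘ (v ∈?_)) L)    ≤⟨ +-monoˡ-≤ _ (<⇒≤ (≰⇒> few-in)) ⟩
    2 ^ length vs * c + length (filter (¬? ∘ (v ∈?_)) L)            ∎))
    where open ≤-Reasoning

module Cliques {n} (G : Graph n) where

  infix 4 _~_
  _~_ : Fin n → Fin n → Set
  _~_ = Adj G

  ~-sym : ∀ {u v} → u ~ v → v ~ u
  ~-sym {u} {v} u~v = trans (Graph.sym G v u) u~v

  ~⇒≢ : ∀ {u v} → u ~ v → u ≢ v
  ~⇒≢ {u} u~u refl with trans (sym u~u) (irrefl G u)
  ... | ()

  _~?_ : ∀ u v → Dec (u ~ v)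
  u ~? v = adj G u v Bool.≟ true

  IsClique : ∀ {m} → (Fin m → Fin n) → Set
  IsClique f = ∀ i j → i ≢ j → f i ~ f j

  clique⇒injective : ∀ {m} {f : Fin m → Fin n} → IsClique f → Injective _≡_ _≡_ f
  clique⇒injective f-clique {i} {j} fi≡fj with i Finₚ.≟ j
  ... | yes i≡j = i≡j
  ... | no  i≢j = ⊥-elim (~⇒≢ (f-clique i j i≢j) fi≡fj)

  ∷-clique : ∀ {m v} {f : Fin m → Fin n} → IsClique f → (∀ i → v ~ f i) → IsClique (v ∷ᶠ f)
  ∷-clique f-clique v~f zero    zero    0≢0   = ⊥-elim (0≢0 refl)
  ∷-clique f-clique v~f zero    (suc j) _     = v~f j
  ∷-clique f-clique v~f (suc i) zero    _     = ~-sym (v~f i)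
  ∷-clique f-clique v~f (suc i) (suc j) si≢sj = f-clique i j (si≢sj ∘ cong suc)

  removeAt-clique : ∀ {m} {f : Fin (suc m) → Fin n} → IsClique f → ∀ a → IsClique (removeAt f a)
  removeAt-clique f-clique a i j i≢j = f-clique _ _ (i≢j ∘ Finₚ.punchIn-injective a i j)

  image-clique : ∀ {m} {f : Fin m → Fin n} → IsClique f →
                 ∀ {u v} → u ∈ image f → v ∈ image f → u ≢ v → u ~ v
  image-clique {f = f} f-clique u∈ v∈ u≢v with ∈-image⁻ f u∈ | ∈-image⁻ f v∈
  ... | i , refl | j , refl = f-clique i j (u≢v ∘ cong f)

  ConicalSet : ℕ → Set
  ConicalSet m = Σ (Subset n) λ X → ∣ X ∣ ≥ m × (∀ v → v ∈ X → Conical G v)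

  AllPairs⇒clique : ∀ {m} {vs : List (Fin n)} → AllPairs _~_ vs → m ≤ length vs →
                    Σ (Fin m → Fin n) λ f → IsClique f × (∀ i → f i ∈ₗ vs)
  AllPairs⇒clique {zero}  _ _ = (λ ()) , (λ ()) , (λ ())
  AllPairs⇒clique {suc m} {v ∷ vs} (v~vs ∷ vs-clique) (s≤s m≤vs)
    with f , f-clique , f∈vs ← AllPairs⇒clique vs-clique m≤vs
    = v ∷ᶠ f , ∷-clique f-clique (λ i → All.lookup v~vs (f∈vs i)) ,
      λ { zero → here refl ; (suc i) → there (f∈vs i) }

module GoodSets {n} (k : ℕ) (H : Graph n) (K-free : ¬ HasClique H (2 + k) ⊤) where
  open Cliques H

  Good : Subset n → Set
  Good T = MaxFree H (suc k) T × ∣ T ∣ ≡ 2 + k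

  no-K[2+k] : (f : Fin (2 + k) → Fin n) → IsClique f → ⊥
  no-K[2+k] f f-clique = K-free (f , (λ _ → ∈⊤) , f-clique)

  no-K[1+k]-in : ∀ {T} → Good T → (f : Fin (suc k) → Fin n) → (∀ i → f i ∈ T) → IsClique f → ⊥
  no-K[1+k]-in good f f∈T f-clique = proj₁ (proj₁ good) (f , f∈T , f-clique)

  good⊈ : ∀ {T q} → Good T → ∣ q ∣ ≤ suc k → ∃ λ v → v ∈ T × v ∉ q
  good⊈ good ∣q∣≤1+k = ∣q∣<∣p∣⇒p⊈q (≤-trans (s≤s ∣q∣≤1+k) (≤-reflexive (sym (proj₂ good))))

  record Extension (T : Subset n) (u : Fin n) : Set where
    field
      clique   : Fin (suc k) → Fin n
      isClique : IsClique clique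
      ⊆T∪u     : ∀ i → clique i ∈ T ∪ ⁅ u ⁆
      u∈       : u ∈ image clique

    K : Subset n
    K = image clique

    K-adj : ∀ {v w} → v ∈ K → w ∈ K → v ≢ w → v ~ w
    K-adj = image-clique isClique

    K-stable : ∀ {v} → ¬ v ∉ K → v ∈ K
    K-stable = decidable-stable (_ ∈? K)

    K-small : (f : Fin (2 + k) → Fin n) → Injective _≡_ _≡_ f → (∀ i → f i ∈ K) → ⊥
    K-small f f-inj f∈K = 1+n≰n (≤-trans (injection⇒≤∣p∣ f f-inj f∈K) (∣image∣≤ clique))

  extend : ∀ {T u} → Good T → u ∉ T → Extension T u
  extend {T} {u} good u∉T with proj₂ (proj₁ good) u u∉T
  ... | f , f⊆T∪u , f-clique = record
    { clique = f ; isClique = f-clique ; ⊆T∪u = f⊆T∪u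
    ; u∈ = decidable-stable (u ∈? image f) λ u∉f →
             no-K[1+k]-in good f (f⊆T u∉f) f-clique }
    where
    f⊆T : u ∉ image f → ∀ i → f i ∈ T
    f⊆T u∉f i with ∈-∪⁅⁆⁻ (f⊆T∪u i)
    ... | inj₁ fi∈T = fi∈T
    ... | inj₂ fi≡u = ⊥-elim (∉-image⇒≢ f u∉f i fi≡u)

  misses-at-most-two : ∀ {T u} → Good T → (E : Extension T u) → let open Extension E in
                       ∀ {a b c} → a ∈ T → b ∈ T → c ∈ T → a ≢ b → a ≢ c → b ≢ c →
                       a ∉ K → b ∉ K → c ∉ K → ⊥
  misses-at-most-two {T} {u} good E {a} {b} {c} a∈ b∈ c∈ a≢b a≢c b≢c a∉K b∉K c∉K =
    1+n≰n (begin
      4 + k                          ≤⟨ +-monoʳ-≤ 3 (injection⇒≤∣p∣ clique (clique⇒injective isClique) avoids) ⟩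
      3 + ∣ T ∪ ⁅ u ⁆ - a - b - c ∣  ≤⟨ 3+∣p-x-y-z∣≤∣p∣ (T⊆T∪u a∈) (T⊆T∪u b∈) (T⊆T∪u c∈) a≢b a≢c b≢c ⟩
      ∣ T ∪ ⁅ u ⁆ ∣                  ≤⟨ ∣p∪⁅x⁆∣≤1+∣p∣ T u ⟩
      suc ∣ T ∣                      ≡⟨ cong suc (proj₂ good) ⟩
      3 + k                          ∎)
    where
    open Extension E
    open ≤-Reasoning
    T⊆T∪u = p⊆p∪q ⁅ u ⁆
    avoids : ∀ i → clique i ∈ T ∪ ⁅ u ⁆ - a - b - c
    avoids i = x∈p∧x≢y⇒x∈p-y (x∈p∧x≢y⇒x∈p-y (x∈p∧x≢y⇒x∈p-y (⊆T∪u i) (∉-image⇒≢ clique a∉K i))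
                                              (∉-image⇒≢ clique b∉K i))
                             (∉-image⇒≢ clique c∉K i)

module Kernel {n j} (H : Graph n) (K-free : ¬ HasClique H (4 + j) ⊤)
              (A : Fin (2 + j) → Fin n) (A-clique : Cliques.IsClique H A) where
  open Cliques H
  open GoodSets (2 + j) H K-free

  k : ℕ
  k = 2 + j

  A-injective : Injective _≡_ _≡_ A
  A-injective = clique⇒injective A-clique

  record Split (T : Subset n) (x y : Fin n) : Set where
    field
      good  : Good T
      A⊆T   : ∀ i → A i ∈ T
      x∈T   : x ∈ T
      y∈T   : y ∈ T
      x∉A   : x ∉ image A
      y∉A   : y ∉ image A
      x≢y   : x ≢ y
      cover : ∀ {v} → v ∈ T → v ∈ image A ⊎ v ≡ x ⊎ v ≡ y

  swap : ∀ {T x y} → Split T x y → Split T y x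
  swap s = record
    { good = good ; A⊆T = A⊆T ; x∈T = y∈T ; y∈T = x∈T ; x∉A = y∉A ; y∉A = x∉A
    ; x≢y = x≢y ∘ sym ; cover = Sum.map₂ Sum.swap ∘ cover }
    where open Split s

  splitting : ∀ {T} → Good T → (∀ i → A i ∈ T) → ∃₂ (Split T)
  splitting {T} good A⊆T
    with x , x∈T , x∉A   ← good⊈ good (≤-trans (∣image∣≤ A) (n≤1+n k))
    with y , y∈T , y∉A∪x ← good⊈ good (≤-trans (∣p∪⁅x⁆∣≤1+∣p∣ (image A) x) (s≤s (∣image∣≤ A)))
    = x , y , record
      { good = good ; A⊆T = A⊆T ; x∈T = x∈T ; y∈T = y∈T ; x∉A = x∉A ; y∉A = y∉A
      ; x≢y = x≢y ; cover = cover }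
    where
    y∉A : y ∉ image A
    y∉A = y∉A∪x ∘ p⊆p∪q ⁅ x ⁆
    x≢y : x ≢ y
    x≢y x≡y = y∉A∪x (q⊆p∪q (image A) ⁅ x ⁆ (subst (_∈ ⁅ x ⁆) x≡y (x∈⁅x⁆ x)))
    cover : ∀ {v} → v ∈ T → v ∈ image A ⊎ v ≡ x ⊎ v ≡ y
    cover {v} v∈T with v ∈? image A | v Finₚ.≟ x | v Finₚ.≟ y
    ... | yes v∈A | _       | _       = inj₁ v∈A
    ... | no  _   | yes v≡x | _       = inj₂ (inj₁ v≡x)
    ... | no  _   | no  _   | yes v≡y = inj₂ (inj₂ v≡y)
    ... | no  v∉A | no  v≢x | no  v≢y = ⊥-elim (1+n≰n
      (≤-trans (injection⇒≤∣p∣ (v ∷ᶠ y ∷ᶠ x ∷ᶠ A) vyxA-injective vyxA∈T) (≤-reflexive (proj₂ good))))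
      where
      vyxA∈T : ∀ i → (v ∷ᶠ y ∷ᶠ x ∷ᶠ A) i ∈ T
      vyxA∈T zero                = v∈T
      vyxA∈T (suc zero)          = y∈T
      vyxA∈T (suc (suc zero))    = x∈T
      vyxA∈T (suc (suc (suc i))) = A⊆T i
      vyxA-injective : Injective _≡_ _≡_ (v ∷ᶠ y ∷ᶠ x ∷ᶠ A)
      vyxA-injective = injective-∷ (injective-∷ (injective-∷ A-injective (∉-image⇒≢ A x∉A))
                                      (λ { zero → x≢y ; (suc i) → ∉-image⇒≢ A y∉A i }))
                                    (λ { zero → v≢y ∘ sym ; (suc zero) → v≢x ∘ sym
                                       ; (suc (suc i)) → ∉-image⇒≢ A v∉A i })

  petal : ∀ {T x y z} → Split T x y → z ∈ T → z ∉ image A → z ≡ x ⊎ z ≡ y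
  petal s z∈T z∉A with Split.cover s z∈T
  ... | inj₁ z∈A = ⊥-elim (z∉A z∈A)
  ... | inj₂ z≡x⊎y = z≡x⊎y

  views : ∀ {T x y z w} → Split T x y → Split T z w → (z ≡ x × w ≡ y) ⊎ (z ≡ y × w ≡ x)
  views s t with petal s (Split.x∈T t) (Split.x∉A t) | petal s (Split.y∈T t) (Split.y∉A t)
  ... | inj₁ z≡x | inj₂ w≡y = inj₁ (z≡x , w≡y)
  ... | inj₂ z≡y | inj₁ w≡x = inj₂ (z≡y , w≡x)
  ... | inj₁ z≡x | inj₁ w≡x = ⊥-elim (Split.x≢y t (trans z≡x (sym w≡x)))
  ... | inj₂ z≡y | inj₂ w≡y = ⊥-elim (Split.x≢y t (trans z≡y (sym w≡y)))

  Split-unique : ∀ {T T′ x y} → Split T x y → Split T′ x y → T ≡ T′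
  Split-unique s s′ = ⊆-antisym (⊆ s s′) (⊆ s′ s)
    where
    ⊆ : ∀ {T T′ x y} → Split T x y → Split T′ x y → T ⊆ T′
    ⊆ s s′ v∈T with Split.cover s v∈T
    ... | inj₁ v∈A        = let i , Ai≡v = ∈-image⁻ A v∈A in subst (_∈ _) Ai≡v (Split.A⊆T s′ i)
    ... | inj₂ (inj₁ refl) = Split.x∈T s′
    ... | inj₂ (inj₂ refl) = Split.y∈T s′

  CompleteBut : Fin k → Fin n → Set
  CompleteBut a v = ∀ i → i ≢ a → v ~ A i

  complete : ∀ {a v} → v ~ A a → CompleteBut a v → ∀ i → v ~ A i
  complete {a} v~Aa v-complete i with i Finₚ.≟ a
  ... | yes refl = v~Aa
  ... | no  i≢a  = v-complete i i≢a

  complete-removeAt : ∀ {a v} → CompleteBut a v → ∀ i → v ~ removeAt A a i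
  complete-removeAt {a} v-complete i = v-complete _ (Finₚ.punchInᵢ≢i a i)

  petal-incomplete : ∀ {T x y} → Split T x y → ¬ (∀ i → x ~ A i)
  petal-incomplete {T} {x} s x~A = no-K[1+k]-in good (x ∷ᶠ A) xA⊆T (∷-clique A-clique x~A)
    where
    open Split s
    xA⊆T : ∀ i → (x ∷ᶠ A) i ∈ T
    xA⊆T zero    = x∈T
    xA⊆T (suc i) = A⊆T i

  adjacent-petals-incomplete : ∀ {T x y} → Split T x y → x ~ y → ∀ a →
                               ¬ (CompleteBut a x × CompleteBut a y)
  adjacent-petals-incomplete {T} {x} {y} s x~y a (x-complete , y-complete) =
    no-K[1+k]-in good (x ∷ᶠ y ∷ᶠ removeAt A a) xyA⊆T
      (∷-clique (∷-clique (removeAt-clique A-clique a) (complete-removeAt y-complete))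
                (λ { zero → x~y ; (suc i) → complete-removeAt x-complete i }))
    where
    open Split s
    xyA⊆T : ∀ i → (x ∷ᶠ y ∷ᶠ removeAt A a) i ∈ T
    xyA⊆T zero          = x∈T
    xyA⊆T (suc zero)    = y∈T
    xyA⊆T (suc (suc i)) = A⊆T _

  module _ {T x y u} (s : Split T x y) (E : Extension T u) where
    open Split s
    open Extension E

    misses-kernel-and-petals : ∀ {a} → A a ∉ K → x ∉ K → y ∉ K → ⊥
    misses-kernel-and-petals {a} =
      misses-at-most-two good E (A⊆T a) x∈T y∈T (∉-image⇒≢ A x∉A a) (∉-image⇒≢ A y∉A a) x≢y

    misses-two-kernel-and-petal : ∀ {a b} → a ≢ b → A a ∉ K → A b ∉ K → y ∉ K → ⊥
    misses-two-kernel-and-petal {a} {b} a≢b =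
      misses-at-most-two good E (A⊆T a) (A⊆T b) y∈T
        (a≢b ∘ A-injective) (∉-image⇒≢ A y∉A a) (∉-image⇒≢ A y∉A b)

    misses-three-kernel : ∀ {a b c} → a ≢ b → a ≢ c → b ≢ c → A a ∉ K → A b ∉ K → A c ∉ K → ⊥
    misses-three-kernel {a} {b} {c} a≢b a≢c b≢c =
      misses-at-most-two good E (A⊆T a) (A⊆T b) (A⊆T c)
        (a≢b ∘ A-injective) (a≢c ∘ A-injective) (b≢c ∘ A-injective)

  -- For w ∉ T, a K_{k+1} through w in T ∪ ⁅ w ⁆ missing A i cannot contain both x and y
  -- (x ≁ y), nor contain A a together with one of them (x, y ≁ A a).
  petals-complete⇒conical : ∀ {T x y a} → Split T x y → CompleteBut a x → CompleteBut a y →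
                            ∀ i → i ≢ a → Conical H (A i)
  petals-complete⇒conical {T} {x} {y} {a} s x-complete y-complete i i≢a w w≢Ai with w ∈? T
  ... | yes w∈T = adj-in-T (Split.cover s w∈T)
    where
    adj-in-T : w ∈ image A ⊎ w ≡ x ⊎ w ≡ y → A i ~ w
    adj-in-T (inj₁ w∈A)        = image-clique A-clique (∈-image⁺ A i) w∈A (w≢Ai ∘ sym)
    adj-in-T (inj₂ (inj₁ refl)) = ~-sym (x-complete i i≢a)
    adj-in-T (inj₂ (inj₂ refl)) = ~-sym (y-complete i i≢a)
  ... | no w∉T = K-adj (K-stable Ai∉K-impossible) u∈ (w≢Ai ∘ sym)
    where
    open Split s
    E = extend good w∉T
    open Extension E
    Ai∉K-impossible : A i ∉ K → ⊥
    Ai∉K-impossible Ai∉K with A a ∈? K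
    ... | yes Aa∈K = misses-kernel-and-petals s E Ai∉K (petal∉K s x-complete) (petal∉K (swap s) y-complete)
      where
      petal∉K : ∀ {z w} → Split T z w → CompleteBut a z → z ∉ K
      petal∉K t z-complete z∈K =
        petal-incomplete t (complete (K-adj z∈K Aa∈K (∉-image⇒≢ A (Split.x∉A t) a ∘ sym)) z-complete)
    ... | no Aa∉K = adjacent-petals-incomplete s (K-adj x∈K y∈K x≢y) a (x-complete , y-complete)
      where
      x∈K = K-stable (misses-two-kernel-and-petal (swap s) E i≢a Ai∉K Aa∉K)
      y∈K = K-stable (misses-two-kernel-and-petal s E i≢a Ai∉K Aa∉K)

  conical-set : ∀ {T x y a} → Split T x y → CompleteBut a x → CompleteBut a y → ConicalSet (suc j)
  conical-set {a = a} s x-complete y-complete =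
    image (removeAt A a) ,
    injection⇒≤∣p∣ (removeAt A a) (clique⇒injective (removeAt-clique A-clique a))
                                  (∈-image⁺ (removeAt A a)) ,
    λ v v∈ → let i , Ai≡v = ∈-image⁻ (removeAt A a) v∈ in
      subst (Conical H) Ai≡v (petals-complete⇒conical s x-complete y-complete _ (Finₚ.punchInᵢ≢i a i))

  PetalDisjoint : Subset n → Subset n → Set
  PetalDisjoint T T′ = ∀ {v} → v ∈ T → v ∈ T′ → v ∈ image A

  PetalDisjoint-sym : ∀ {T T′} → PetalDisjoint T T′ → PetalDisjoint T′ T
  PetalDisjoint-sym disj v∈T′ v∈T = disj v∈T v∈T′

  petal∉ : ∀ {T T′ z w} → PetalDisjoint T T′ → Split T′ z w → z ∉ T
  petal∉ disj t z∈T = Split.x∉A t (disj z∈T (Split.x∈T t))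

  record SplitSet : Set where
    constructor ⟨_⟩
    field
      {T}   : Subset n
      {x y} : Fin n
      split : Split T x y

  open SplitSet using (T)

  other-petal : ∀ {T x y z} → Split T x y → z ∈ T → z ∉ image A → ∃ (Split T z)
  other-petal s z∈T z∉A with petal s z∈T z∉A
  ... | inj₁ refl = _ , s
  ... | inj₂ refl = _ , swap s

  -- A K_{k+1} through w′ in T ∪ ⁅ w′ ⁆ avoiding w would lie in A ∪ ⁅ z ⁆ ∪ ⁅ w′ ⁆ = T′.
  shared-petal-adj : ∀ {T T′ z w w′} → Split T z w → Split T′ z w′ → T ≢ T′ → w ~ w′
  shared-petal-adj {T} {T′} {z} {w} {w′} t t′ T≢T′ =
    K-adj (K-stable λ w∉K → no-K[1+k]-in (Split.good t′) clique (⊆T′ w∉K) isClique) u∈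
          (∉∧∈⇒≢ w′∉T (Split.y∈T t) ∘ sym)
    where
    w′∉T : w′ ∉ T
    w′∉T w′∈T with petal t w′∈T (Split.y∉A t′)
    ... | inj₁ w′≡z = Split.x≢y t′ (sym w′≡z)
    ... | inj₂ refl = T≢T′ (Split-unique t t′)
    open Extension (extend (Split.good t) w′∉T)
    ⊆T′ : w ∉ K → ∀ i → clique i ∈ T′
    ⊆T′ w∉K i with ∈-∪⁅⁆⁻ (⊆T∪u i)
    ... | inj₂ ci≡w′ = subst (_∈ T′) (sym ci≡w′) (Split.y∈T t′)
    ... | inj₁ ci∈T with Split.cover t ci∈T
    ...   | inj₁ ci∈A = let a , Aa≡ci = ∈-image⁻ A ci∈A in subst (_∈ T′) Aa≡ci (Split.A⊆T t′ a)
    ...   | inj₂ (inj₁ ci≡z) = subst (_∈ T′) (sym ci≡z) (Split.x∈T t′)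
    ...   | inj₂ (inj₂ ci≡w) = ⊥-elim (∉-image⇒≢ clique w∉K i ci≡w)

  Distinct : List SplitSet → Set
  Distinct = AllPairs (λ e e′ → T e ≢ T e′)

  few-through : ∀ {z G} → z ∉ image A → Distinct G → All (λ e → z ∈ T e) G → length G ≤ suc k
  few-through {z} z∉A G-distinct z∈G = ≮⇒≥ λ k<G →
    let f , f-clique , _ = AllPairs⇒clique (others-adj G-distinct z∈G)
                                            (≤-trans k<G (≤-reflexive (sym (others-length z∈G))))
    in no-K[2+k] f f-clique
    where
    other : ∀ e → z ∈ T e → ∃ (Split (T e) z)
    other e z∈e = other-petal (SplitSet.split e) z∈e z∉A
    others : ∀ {G} → All (λ e → z ∈ T e) G → List (Fin n)
    others []                    = []
    others {e ∷ _} (z∈e ∷ z∈G) = proj₁ (other e z∈e) ∷ others z∈G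
    others-length : ∀ {G} (z∈G : All (λ e → z ∈ T e) G) → length (others z∈G) ≡ length G
    others-length []          = refl
    others-length (_ ∷ z∈G) = cong suc (others-length z∈G)
    others-adj : ∀ {G} → Distinct G → (z∈G : All (λ e → z ∈ T e) G) → AllPairs _~_ (others z∈G)
    others-adj []                   []             = []
    others-adj {e ∷ _} (e≢G ∷ G-distinct) (z∈e ∷ z∈G) = head-adj e≢G z∈G ∷ others-adj G-distinct z∈G
      where
      head-adj : ∀ {G} → All (λ e′ → T e ≢ T e′) G → (z∈G : All (λ e → z ∈ T e) G) →
                 All (proj₁ (other e z∈e) ~_) (others z∈G)
      head-adj           []            []              = []
      head-adj {e′ ∷ _} (e≢e′ ∷ e≢G) (z∈e′ ∷ z∈G) =
        shared-petal-adj (proj₂ (other e z∈e)) (proj₂ (other e′ z∈e′)) e≢e′ ∷ head-adj e≢G z∈G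

  Disjoint : List SplitSet → Set
  Disjoint = AllPairs (λ e e′ → PetalDisjoint (T e) (T e′))

  discard-through-petals : ∀ e {G} → Distinct G →
                           ∃ λ G′ → Distinct G′ × All (λ e′ → e′ ∈ₗ G × PetalDisjoint (T e) (T e′)) G′ ×
                                    length G ≤ suc k + suc k + length G′
  discard-through-petals e {G} G-distinct =
    G₂ , AllPairs.filter⁺ _ (AllPairs.filter⁺ _ G-distinct) , All.tabulate kept-disjoint , G≤
    where
    open SplitSet e using (x; y; split)
    open Split split using (x∉A; y∉A; cover)
    through : ∀ v → Decidable (λ e′ → v ∈ T e′)
    through v e′ = v ∈? T e′
    G₁ = filter (¬? ∘ through x) G
    G₂ = filter (¬? ∘ through y) G₁
    kept-disjoint : ∀ {e′} → e′ ∈ₗ G₂ → e′ ∈ₗ G × PetalDisjoint (T e) (T e′)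
    kept-disjoint {e′} e′∈G₂ = e′∈G , disjoint
      where
      e′∈G₁,y∉e′ = ∈ₗ.∈-filter⁻ (¬? ∘ through y) {xs = G₁} e′∈G₂
      e′∈G,x∉e′  = ∈ₗ.∈-filter⁻ (¬? ∘ through x) {xs = G} (proj₁ e′∈G₁,y∉e′)
      e′∈G = proj₁ e′∈G,x∉e′
      disjoint : PetalDisjoint (T e) (T e′)
      disjoint v∈e v∈e′ with cover v∈e
      ... | inj₁ v∈A        = v∈A
      ... | inj₂ (inj₁ refl) = ⊥-elim (proj₂ e′∈G,x∉e′ v∈e′)
      ... | inj₂ (inj₂ refl) = ⊥-elim (proj₂ e′∈G₁,y∉e′ v∈e′)
    few-x : length (filter (through x) G) ≤ suc k
    few-x = few-through x∉A (AllPairs.filter⁺ _ G-distinct) (All.all-filter _ G)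
    few-y : length (filter (through y) G₁) ≤ suc k
    few-y = few-through y∉A (AllPairs.filter⁺ _ (AllPairs.filter⁺ _ G-distinct)) (All.all-filter _ G₁)
    G≤ : length G ≤ suc k + suc k + length G₂
    G≤ = begin
      length G                                                              ≡⟨ length-filter-split (through x) G ⟩
      length (filter (through x) G) + length G₁
        ≡⟨ cong (length (filter (through x) G) +_) (length-filter-split (through y) G₁) ⟩
      length (filter (through x) G) + (length (filter (through y) G₁) + length G₂)
        ≤⟨ +-mono-≤ few-x (+-monoˡ-≤ _ few-y) ⟩
      suc k + (suc k + length G₂)                                           ≡⟨ sym (+-assoc (suc k) _ _) ⟩
      suc k + suc k + length G₂                                             ∎
      where open ≤-Reasoning

  disjoint-sublist : ∀ m {G} → Distinct G → m * suc (suc k + suc k) ≤ length G →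
                     ∃ λ P → Disjoint P × All (_∈ₗ G) P × m ≤ length P
  disjoint-sublist zero    _                  _           = [] , [] , [] , z≤n
  disjoint-sublist (suc m) {e ∷ G} (_ ∷ G-distinct) (s≤s bound)
    with G′ , G′-distinct , G′-kept , G≤ ← discard-through-petals e G-distinct
    with P , P-disjoint , P⊆G′ , m≤P ←
         disjoint-sublist m G′-distinct (+-cancelˡ-≤ (suc k + suc k) _ _ (≤-trans bound G≤))
    = e ∷ P , All.map (proj₂ ∘ All.lookup G′-kept) P⊆G′ ∷ P-disjoint ,
      here refl ∷ All.map (there ∘ proj₁ ∘ All.lookup G′-kept) P⊆G′ , s≤s m≤P

  module Outsider (p : Fin n) (a : Fin k) (p≁Aa : ¬ p ~ A a) where

    CompleteBut₂ : Fin k → Fin n → Set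
    CompleteBut₂ c v = ∀ i → i ≢ a → i ≢ c → v ~ A i

    record OnePetal (T : Subset n) : Set where
      field
        z w        : Fin n
        split      : Split T z w
        p~z        : p ~ z
        p-complete : CompleteBut a p
        z-complete : CompleteBut a z

    record BothPetals (T : Subset n) (c : Fin k) : Set where
      field
        c≢a            : c ≢ a
        p-complete     : CompleteBut₂ c p
        x y            : Fin n
        split          : Split T x y
        p~petal        : ∀ {z w} → Split T z w → p ~ z
        petals-adj     : ∀ {z w} → Split T z w → z ~ w
        petal-complete : ∀ {z w} → Split T z w → CompleteBut₂ c z

    -- The clique through p in T ∪ ⁅ p ⁆ misses A a and exactly one more vertex: a petal (class zero)
    -- or A c (class suc c).
    Class : Subset n → Fin (suc k) → Set
    Class T zero    = OnePetal T
    Class T (suc c) = BothPetals T c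

    classify : ∀ {T x y} → Split T x y → p ∉ T → ∃ (Class T)
    classify {T} {x} {y} s p∉T = by-petals (x ∈? K) (y ∈? K)
      where
      open Split s
      E = extend good p∉T
      open Extension E
      p≢ : ∀ {v} → v ∈ T → p ≢ v
      p≢ = ∉∧∈⇒≢ p∉T
      p~ : ∀ {v} → v ∈ T → v ∈ K → p ~ v
      p~ v∈T v∈K = K-adj u∈ v∈K (p≢ v∈T)
      Aa∉K : A a ∉ K
      Aa∉K Aa∈K = p≁Aa (p~ (A⊆T a) Aa∈K)
      one-petal : ∀ {z w} → Split T z w → z ∈ K → w ∉ K → OnePetal T
      one-petal {z} {w} t z∈K w∉K = record
        { z = z ; w = w ; split = t ; p~z = p~ z∈T z∈K
        ; p-complete = λ i i≢a → p~ (A⊆T i) (Ai∈K i≢a)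
        ; z-complete = λ i i≢a → K-adj z∈K (Ai∈K i≢a) (∉-image⇒≢ A z∉A i ∘ sym) }
        where
        open Split t using () renaming (x∈T to z∈T; x∉A to z∉A)
        Ai∈K : ∀ {i} → i ≢ a → A i ∈ K
        Ai∈K i≢a = K-stable λ Ai∉K → misses-two-kernel-and-petal t E (i≢a ∘ sym) Aa∉K Ai∉K w∉K
      both-petals : x ∈ K → y ∈ K → ∃ (BothPetals T)
      both-petals x∈K y∈K with Finₚ.any? (λ i → ¬? (removeAt A a i ∈? K))
      ... | no none = ⊥-elim (K-small (p ∷ᶠ x ∷ᶠ y ∷ᶠ removeAt A a) pxyA-injective pxyA⊆K)
        where
        pxyA⊆K : ∀ i → (p ∷ᶠ x ∷ᶠ y ∷ᶠ removeAt A a) i ∈ K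
        pxyA⊆K zero                = u∈
        pxyA⊆K (suc zero)          = x∈K
        pxyA⊆K (suc (suc zero))    = y∈K
        pxyA⊆K (suc (suc (suc i))) = K-stable λ Ai∉K → none (i , Ai∉K)
        pxyA-injective : Injective _≡_ _≡_ (p ∷ᶠ x ∷ᶠ y ∷ᶠ removeAt A a)
        pxyA-injective =
          injective-∷ (injective-∷ (injective-∷ (clique⇒injective (removeAt-clique A-clique a))
                                                 (λ i → ∉-image⇒≢ A y∉A _))
                                   (λ { zero → x≢y ∘ sym ; (suc i) → ∉-image⇒≢ A x∉A _ }))
                      (λ { zero → p≢ x∈T ∘ sym ; (suc zero) → p≢ y∈T ∘ sym
                         ; (suc (suc i)) → p≢ (A⊆T _) ∘ sym })
      ... | yes (i , Ac∉K) = c , record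
        { c≢a = c≢a ; p-complete = λ i i≢a i≢c → p~ (A⊆T i) (Ai∈K i≢a i≢c) ; x = x ; y = y ; split = s
        ; p~petal        = λ t → p~ (Split.x∈T t) (petal∈K t)
        ; petals-adj     = λ t → K-adj (petal∈K t) (petal∈K (swap t)) (Split.x≢y t)
        ; petal-complete = λ t i i≢a i≢c →
            K-adj (petal∈K t) (Ai∈K i≢a i≢c) (∉-image⇒≢ A (Split.x∉A t) i ∘ sym) }
        where
        c = punchIn a i
        c≢a = Finₚ.punchInᵢ≢i a i
        Ai∈K : ∀ {i} → i ≢ a → i ≢ c → A i ∈ K
        Ai∈K i≢a i≢c = K-stable λ Ai∉K →
          misses-three-kernel s E (c≢a ∘ sym) (i≢a ∘ sym) (i≢c ∘ sym) Aa∉K Ac∉K Ai∉K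
        petal∈K : ∀ {z w} → Split T z w → z ∈ K
        petal∈K t with petal s (Split.x∈T t) (Split.x∉A t)
        ... | inj₁ refl = x∈K
        ... | inj₂ refl = y∈K
      by-petals : Dec (x ∈ K) → Dec (y ∈ K) → ∃ (Class T)
      by-petals (yes x∈K) (yes y∈K) = let c , b = both-petals x∈K y∈K in suc c , b
      by-petals (yes x∈K) (no  y∉K) = zero , one-petal s x∈K y∉K
      by-petals (no  x∉K) (yes y∈K) = zero , one-petal (swap s) y∈K x∉K
      by-petals (no  x∉K) (no  y∉K) = ⊥-elim (misses-kernel-and-petals s E Aa∉K x∉K y∉K)

    two-OnePetal⇒complete-split : ∀ {T T′} → PetalDisjoint T T′ → OnePetal T → OnePetal T′ →
                                      ∃₂ λ z w → Split T z w × CompleteBut a z × CompleteBut a w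
    two-OnePetal⇒complete-split {T} {T′} disj α α′ = z , w , split , z-complete , w-complete
      where
      open OnePetal α
      open OnePetal α′ using () renaming (z to z′; split to split′; p~z to p~z′; z-complete to z′-complete)
      open Split split using (good; A⊆T; x∈T; x∉A; y∉A)
      z′∉T = petal∉ disj split′
      E = extend good z′∉T
      open Extension E
      z′~ : ∀ {v} → v ∈ T → v ∈ K → z′ ~ v
      z′~ v∈T v∈K = K-adj u∈ v∈K (∉∧∈⇒≢ z′∉T v∈T)
      z∉K : z ∉ K
      z∉K z∈K = no-K[2+k] (p ∷ᶠ z ∷ᶠ z′ ∷ᶠ removeAt A a)
        (∷-clique (∷-clique (∷-clique (removeAt-clique A-clique a) (complete-removeAt z′-complete))
                            (λ { zero → ~-sym (z′~ x∈T z∈K) ; (suc i) → complete-removeAt z-complete i }))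
                  (λ { zero → p~z ; (suc zero) → p~z′ ; (suc (suc i)) → complete-removeAt p-complete i }))
      z′-incomplete = petal-incomplete split′
      Aa∉K : A a ∉ K
      Aa∉K Aa∈K = z′-incomplete (complete (z′~ (A⊆T a) Aa∈K) z′-complete)
      w∈K : w ∈ K
      w∈K = K-stable λ w∉K → z′-incomplete λ i →
        z′~ (A⊆T i) (K-stable λ Ai∉K → misses-kernel-and-petals split E Ai∉K z∉K w∉K)
      w-complete : CompleteBut a w
      w-complete i i≢a = K-adj w∈K Ai∈K (∉-image⇒≢ A y∉A i ∘ sym)
        where
        Ai∈K = K-stable λ Ai∉K → misses-two-kernel-and-petal (swap split) E (i≢a ∘ sym) Aa∉K Ai∉K z∉K

    A-without : ∀ {c} → c ≢ a → Fin j → Fin n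
    A-without c≢a = removeAt (removeAt A a) (punchOut (c≢a ∘ sym))

    complete₂-without : ∀ {c v} (c≢a : c ≢ a) → CompleteBut₂ c v → ∀ i → v ~ A-without c≢a i
    complete₂-without {c} c≢a v-complete i =
      v-complete _ (Finₚ.punchInᵢ≢i a _) λ eq →
        Finₚ.punchInᵢ≢i c′ i (Finₚ.punchIn-injective a _ _ (trans eq (sym (Finₚ.punchIn-punchOut a≢c))))
      where
      a≢c = c≢a ∘ sym
      c′ = punchOut a≢c

    record Link (T : Subset n) (d : Fin k) (z : Fin n) : Set where
      field
        u u′       : Fin n
        split      : Split T u u′
        z~u        : z ~ u
        z-complete : CompleteBut d z
        u-complete : CompleteBut d u

    link : ∀ {T T′ c z w} → PetalDisjoint T T′ → BothPetals T c → BothPetals T′ c → Split T′ z w →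
           Link T a z ⊎ Link T c z
    link {T} {T′} {c} {z} {w} disj β β′ t′ = by-petals (x ∈? K) (y ∈? K)
      where
      open BothPetals β using (c≢a; p-complete; x; y; split; p~petal; petals-adj; petal-complete)
      open Split split using (good; A⊆T; x∈T; y∈T; x≢y)
      z∉T = petal∉ disj t′
      E = extend good z∉T
      open Extension E
      z≢ : ∀ {v} → v ∈ T → z ≢ v
      z≢ = ∉∧∈⇒≢ z∉T
      z~ : ∀ {v} → v ∈ T → v ∈ K → z ~ v
      z~ v∈T v∈K = K-adj u∈ v∈K (z≢ v∈T)
      z-incomplete = petal-incomplete t′
      one-petal : ∀ {u u′} → Split T u u′ → u ∈ K → u′ ∉ K → Link T a z ⊎ Link T c z
      one-petal {u} {u′} t u∈K u′∉K = by-missing (Finₚ.any? (λ i → ¬? (A i ∈? K)))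
        where
        linked : ∀ {d} → A d ∉ K → Link T d z
        linked {d} Ad∉K = record
          { u = u ; u′ = u′ ; split = t ; z~u = z~ (Split.x∈T t) u∈K
          ; z-complete = λ i i≢d → z~ (A⊆T i) (Ai∈K i≢d)
          ; u-complete = λ i i≢d → K-adj u∈K (Ai∈K i≢d) (∉-image⇒≢ A (Split.x∉A t) i ∘ sym) }
          where
          Ai∈K : ∀ {i} → i ≢ d → A i ∈ K
          Ai∈K i≢d = K-stable λ Ai∉K → misses-two-kernel-and-petal t E (i≢d ∘ sym) Ad∉K Ai∉K u′∉K
        by-missing : Dec (∃ λ d → A d ∉ K) → Link T a z ⊎ Link T c z
        by-missing (no none) = ⊥-elim (K-small (u ∷ᶠ z ∷ᶠ A) uzA-injective uzA⊆K)
          where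
          uzA⊆K : ∀ i → (u ∷ᶠ z ∷ᶠ A) i ∈ K
          uzA⊆K zero          = u∈K
          uzA⊆K (suc zero)    = u∈
          uzA⊆K (suc (suc i)) = K-stable λ Ai∉K → none (i , Ai∉K)
          uzA-injective : Injective _≡_ _≡_ (u ∷ᶠ z ∷ᶠ A)
          uzA-injective = injective-∷ (injective-∷ A-injective (λ i → z≢ (A⊆T i) ∘ sym))
                                      (λ { zero → z≢ (Split.x∈T t) ; (suc i) → ∉-image⇒≢ A (Split.x∉A t) i })
        by-missing (yes (d , Ad∉K)) with d Finₚ.≟ a | d Finₚ.≟ c
        ... | yes refl | _        = inj₁ (linked Ad∉K)
        ... | no  _    | yes refl = inj₂ (linked Ad∉K)
        ... | no  d≢a  | no  d≢c  =
          ⊥-elim (z-incomplete (complete (BothPetals.petal-complete β′ t′ d d≢a d≢c)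
                                         (Link.z-complete (linked Ad∉K))))
      by-petals : Dec (x ∈ K) → Dec (y ∈ K) → Link T a z ⊎ Link T c z
      by-petals (yes x∈K) (yes y∈K) = ⊥-elim (no-K[2+k] (p ∷ᶠ x ∷ᶠ y ∷ᶠ z ∷ᶠ A-without c≢a)
        (∷-clique (∷-clique (∷-clique (∷-clique (removeAt-clique (removeAt-clique A-clique a) _)
                                                  (complete₂-without c≢a (BothPetals.petal-complete β′ t′)))
                                      (λ { zero → ~-sym (z~ y∈T y∈K)
                                         ; (suc i) → complete₂-without c≢a (petal-complete (swap split)) i }))
                            (λ { zero → petals-adj split ; (suc zero) → ~-sym (z~ x∈T x∈K)
                               ; (suc (suc i)) → complete₂-without c≢a (petal-complete split) i }))
                  (λ { zero → p~petal split ; (suc zero) → p~petal (swap split)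
                     ; (suc (suc zero)) → BothPetals.p~petal β′ t′
                     ; (suc (suc (suc i))) → complete₂-without c≢a p-complete i })))
      by-petals (yes x∈K) (no  y∉K) = one-petal split x∈K y∉K
      by-petals (no  x∉K) (yes y∈K) = one-petal (swap split) y∈K x∉K
      by-petals (no  x∉K) (no  y∉K) = ⊥-elim (z-incomplete λ i →
        z~ (A⊆T i) (K-stable λ Ai∉K → misses-kernel-and-petals split E Ai∉K x∉K y∉K))

    complete-petal : ∀ {T T′ c} → PetalDisjoint T T′ → BothPetals T c → BothPetals T′ c →
                                   ∃₂ λ z w → Split T′ z w × CompleteBut a z
    complete-petal {c = c} disj β β′
      with link disj β β′ (BothPetals.split β′) | link disj β β′ (swap (BothPetals.split β′))
    ... | inj₁ ℓ | _       = _ , _ , BothPetals.split β′ , Link.z-complete ℓ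
    ... | inj₂ _ | inj₁ ℓ′ = _ , _ , swap (BothPetals.split β′) , Link.z-complete ℓ′
    ... | inj₂ ℓ | inj₂ ℓ′ =
      ⊥-elim (adjacent-petals-incomplete split (petals-adj split) c (Link.z-complete ℓ , Link.z-complete ℓ′))
      where open BothPetals β′ using (split; petals-adj)

    link-complete-petal : ∀ {T T′ c z w} → PetalDisjoint T T′ → BothPetals T c → BothPetals T′ c →
                                          Split T′ z w → CompleteBut a z → ∃₂ λ u u′ → Split T u u′ × CompleteBut a u × z ~ u
    link-complete-petal disj β β′ t′ z-complete with link disj β β′ t′
    ... | inj₁ ℓ = u , u′ , split , u-complete , z~u
      where open Link ℓ
    ... | inj₂ ℓ =
      ⊥-elim (petal-incomplete t′ (complete (Link.z-complete ℓ a (BothPetals.c≢a β ∘ sym)) z-complete))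

    complete-petal-unique : ∀ {T c z w z′ w′} → BothPetals T c → Split T z w → Split T z′ w′ →
                                          CompleteBut a z → CompleteBut a z′ → z′ ≡ z
    complete-petal-unique β t t′ z-complete z′-complete with views t t′
    ... | inj₁ (z′≡z , _) = z′≡z
    ... | inj₂ (refl , _) =
      ⊥-elim (adjacent-petals-incomplete t (BothPetals.petals-adj β t) a (z-complete , z′-complete))

    -- A complete petal of T₁ is linked to complete petals of T₂ and T₃, and these are linked to
    -- each other because T₃ has only one complete petal; together with A − A a that is a K_r.
    ¬three-BothPetals : ∀ {T₁ T₂ T₃ c} → PetalDisjoint T₁ T₂ → PetalDisjoint T₁ T₃ → PetalDisjoint T₂ T₃ →
                           BothPetals T₁ c → BothPetals T₂ c → BothPetals T₃ c → ⊥
    ¬three-BothPetals d₁₂ d₁₃ d₂₃ β₁ β₂ β₃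
      with z₁ , _ , t₁ , z₁-complete ← complete-petal (PetalDisjoint-sym d₁₂) β₂ β₁
      with z₂ , _ , t₂ , z₂-complete , z₁~z₂ ← link-complete-petal (PetalDisjoint-sym d₁₂) β₂ β₁ t₁ z₁-complete
      with z₃ , _ , t₃ , z₃-complete , z₁~z₃ ← link-complete-petal (PetalDisjoint-sym d₁₃) β₃ β₁ t₁ z₁-complete
      with _ , _ , t₃′ , z₃′-complete , z₂~z₃′ ← link-complete-petal (PetalDisjoint-sym d₂₃) β₃ β₂ t₂ z₂-complete
      with refl ← complete-petal-unique β₃ t₃ t₃′ z₃-complete z₃′-complete
      = no-K[2+k] (z₁ ∷ᶠ z₂ ∷ᶠ z₃ ∷ᶠ removeAt A a)
          (∷-clique (∷-clique (∷-clique (removeAt-clique A-clique a) (complete-removeAt z₃-complete))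
                              (λ { zero → z₂~z₃′ ; (suc i) → complete-removeAt z₂-complete i }))
                    (λ { zero → z₁~z₂ ; (suc zero) → z₁~z₃ ; (suc (suc i)) → complete-removeAt z₁-complete i }))

    Item : Set
    Item = ∃ λ e → p ∉ T e

    class : Item → Fin (suc k)
    class (e , p∉e) = proj₁ (classify (SplitSet.split e) p∉e)

    class-of : (i : Item) → Class (T (proj₁ i)) (class i)
    class-of (e , p∉e) = proj₂ (classify (SplitSet.split e) p∉e)

    alike⇒conical : ∀ {κ I} → AllPairs (λ i i′ → PetalDisjoint (T (proj₁ i)) (T (proj₁ i′))) I →
                    All (λ i → class i ≡ κ) I → 2 < length I → ConicalSet (suc j)
    alike⇒conical {I = []}         _ _ ()
    alike⇒conical {I = _ ∷ []}     _ _ (s≤s ())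
    alike⇒conical {I = _ ∷ _ ∷ []} _ _ (s≤s (s≤s ()))
    alike⇒conical {κ} {i₁ ∷ i₂ ∷ i₃ ∷ _} ((d₁₂ ∷ d₁₃ ∷ _) ∷ (d₂₃ ∷ _) ∷ _) (κ₁ ∷ κ₂ ∷ κ₃ ∷ _) _ =
      by-class κ (subst (Class _) κ₁ (class-of i₁)) (subst (Class _) κ₂ (class-of i₂))
                 (subst (Class _) κ₃ (class-of i₃))
      where
      by-class : ∀ κ → Class (T (proj₁ i₁)) κ → Class (T (proj₁ i₂)) κ → Class (T (proj₁ i₃)) κ →
                 ConicalSet (suc j)
      by-class zero α₁ α₂ _ =
        let _ , _ , t , z-complete , w-complete = two-OnePetal⇒complete-split d₁₂ α₁ α₂
        in conical-set t z-complete w-complete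
      by-class (suc c) β₁ β₂ β₃ = ⊥-elim (¬three-BothPetals d₁₂ d₁₃ d₂₃ β₁ β₂ β₃)

  disjoint⇒conical : ∀ {P} → Disjoint P → suc (suc k) * 2 ≤ length P → ConicalSet (suc j)
  disjoint⇒conical {e ∷ P} (e-disjoint ∷ P-disjoint) (s≤s bound)
    with Finₚ.any? (λ i → ¬? (SplitSet.x e ~? A i))
  ... | no  x~A =
    ⊥-elim (petal-incomplete (SplitSet.split e) λ i → decidable-stable (_ ~? _) λ x≁Ai → x~A (i , x≁Ai))
  ... | yes (a , x≁Aa) =
    alike⇒conical (AllPairs.filter⁺ _ items-disjoint) (All.all-filter _ items) (proj₂ many-alike)
    where
    open SplitSet e using (x; split)
    open Outsider x a x≁Aa
    x∉P : All (λ e′ → x ∉ T e′) P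
    x∉P = All.map (λ {e′} (e-e′-disjoint : PetalDisjoint (T e) (T e′)) →
                     petal∉ (PetalDisjoint-sym e-e′-disjoint) split) e-disjoint
    items = All.toList x∉P
    items-disjoint : AllPairs (λ i i′ → PetalDisjoint (T (proj₁ i)) (T (proj₁ i′))) items
    items-disjoint = AllPairs-toList P-disjoint x∉P
    many-alike = pigeonhole-filter Finₚ._≟_ class (List.allFin (suc k)) items (λ _ → ∈ₗ.∈-allFin _)
      (subst₂ (λ m l → m * 2 < l) (sym (Listₚ.length-tabulate {n = suc k} id)) (sym (length-toList x∉P))
              bound)

  many-supersets⇒conical : ∀ {L} → AllPairs _≢_ L → All (λ T → Good T × (∀ i → A i ∈ T)) L →
                           suc (suc k) * 2 * suc (suc k + suc k) ≤ length L → ConicalSet (suc j)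
  many-supersets⇒conical L-distinct L-good bound =
    let P , P-disjoint , _ , P-large = disjoint-sublist (suc (suc k) * 2) G-distinct G-large
    in disjoint⇒conical P-disjoint P-large
    where
    as-SplitSet : (∃ λ T → Good T × (∀ i → A i ∈ T)) → SplitSet
    as-SplitSet (T , good , A⊆T) = ⟨ proj₂ (proj₂ (splitting good A⊆T)) ⟩
    G = List.map as-SplitSet (All.toList L-good)
    G-distinct : Distinct G
    G-distinct = AllPairs.map⁺ (AllPairs-toList L-distinct L-good)
    G-large = ≤-trans bound (≤-reflexive (sym
      (trans (Listₚ.length-map as-SplitSet (All.toList L-good)) (length-toList L-good))))

-- 2ʳ for the homogenisation on S₀, times 2k + 3 sets used up by each of the 2(k + 2) members
-- of the greedy disjoint family.
rt-system-bound : ℕ → ℕ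
rt-system-bound j = let k = 2 + j in 2 ^ (2 + k) * (suc (suc k) * 2 * suc (suc k + suc k))

rt-system⇒conical : ∀ {n j} {H : Graph n} {F} → IsRTSystem (4 + j) (4 + j) H F →
                    rt-system-bound j ≤ length F → Cliques.ConicalSet H (suc j)
rt-system⇒conical {j = j} {F = []} _ bound
  with () ← ≤-trans (*-mono-≤ (m^n>0 2 (4 + j)) (s≤s z≤n)) bound
rt-system⇒conical {n} {j} {H} {S₀ ∷ F} ((K-free , F-maxfree , F-meet) , F-unique , F-size) bound
  with L , L-distinct , L⊆F , c≤L , homogeneous ←
       homogeneous-sublist (members S₀) F-unique (All.tabulate id)
         (subst (λ m → 2 ^ m * _ ≤ _) (sym (trans (length-members S₀) (F-size S₀ (here refl)))) bound)
  with T₁ , T₁∈L , T₁≢S₀ ← another (Vecₚ.≡-dec Bool._≟_) L-distinct (≤-trans (s≤s (s≤s z≤n)) c≤L) S₀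
  with A , A⊆S₀∩T₁ , A-clique ← F-meet S₀ T₁ (here refl) (All.lookup L⊆F T₁∈L) (T₁≢S₀ ∘ sym)
  = many-supersets⇒conical L-distinct (All.tabulate λ T∈L → good T∈L , A⊆ T∈L) c≤L
  where
  open Kernel H K-free A A-clique using (many-supersets⇒conical)
  open GoodSets (2 + j) H K-free using (Good)
  good : ∀ {T} → T ∈ₗ L → Good T
  good T∈L = F-maxfree _ (All.lookup L⊆F T∈L) , F-size _ (All.lookup L⊆F T∈L)
  A⊆ : ∀ {T} → T ∈ₗ L → ∀ i → A i ∈ T
  A⊆ T∈L i with homogeneous (∈-members (proj₁ (x∈p∩q⁻ S₀ T₁ (A⊆S₀∩T₁ i))))
  ... | inj₁ Ai∈L = All.lookup Ai∈L T∈L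
  ... | inj₂ Ai∉L = ⊥-elim (All.lookup Ai∉L T₁∈L (proj₂ (x∈p∩q⁻ S₀ T₁ (A⊆S₀∩T₁ i))))

lemma35 : (r : ℕ) → r ≥ 3 →
    Σ ℕ λ C →
      ∀ (n : ℕ) (H : Graph n) (F : List (Subset n)) →
        IsRTSystem r r H F → length F ≥ C →
        Σ (Subset n) λ X → (∣ X ∣ ≥ r ∸ 3) × (∀ v → v ∈ X → Conical H v)
lemma35 1                         (s≤s ())
lemma35 2                         (s≤s (s≤s ()))
lemma35 3                         _ = 0 , λ _ _ _ _ _ → ∅ , z≤n , λ _ v∈∅ → ⊥-elim (∉⊥ v∈∅)
lemma35 (suc (suc (suc (suc j)))) _ = rt-system-bound j , λ n H F → rt-system⇒conical {n} {j} {H} {F}
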